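{- For every $s$-regular graph $G$, $r(G)\le \xi(G)$.
   Context: Graphs are finite, connected, may have multiple edges but no loops. The resistance $r(G)$ is the minimum number of edges that have to be removed from $G$ to obtain a $\Delta(G)$-edge-colorable subgraph. A 2-factorization of a $2n$-regular graph is a decomposition of its edge set into $n$ edge-disjoint 2-factors (spanning 2-regular subgraphs). For a 2-factorization $\mathcal F$, $o(\mathcal F)$ is the number of odd cycles in the 2-factors of $\mathcal F$. The oddness of an $s$-regular graph $G$ is: $\xi(G)=\min\{o(\mathcal F):\mathcal F \text{ a 2-factorization of } G\}$ if $s$ is even; $\xi(G)=\min\{\xi(G-F_1): F_1 \text{ a 1-factor of } G\}$ if $s$ is odd and $G$ has a 1-factor; and $\xi(G)=\infty$ otherwise. -}

module Defs where

open import Data.Nat using (ℕ; zero; suc; _+_; _*_; _≤_; _⊔_; _%_)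
open import Data.Nat.Properties using () renaming (_≟_ to _≟ℕ_)
open import Data.Fin using (Fin)
open import Data.Fin.Properties using () renaming (_≟_ to _≟F_)
open import Data.Fin.Subset using (Subset; _∈_; ∣_∣; ⊤; ∁)
open import Data.Fin.Subset.Properties using (_∈?_)
open import Data.Bool using (_∧_)
open import Data.Vec using (tabulate)
open import Data.List using (List; length; filter; allFin; map; foldr)
open import Data.Nat.ListAction using (sum)
open import Data.Product using (Σ; ∃; ∃-syntax; _×_; _,_; proj₁; proj₂)
open import Data.Sum using (_⊎_)
open import Relation.Nullary using (¬_; Dec; does)
open import Relation.Nullary.Decidable using (_×-dec_; _⊎-dec_)
open import Relation.Binary.PropositionalEquality using (_≡_; _≢_)
open import Function.Bundles using (_⇔_)
open import Function.Definitions using (Surjective)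

-- Finite loopless multigraph: vertices Fin n, edges Fin m, each edge has two
-- distinct endpoints (parallel edges allowed).
record Graph : Set where
  field
    n : ℕ
    m : ℕ
    ends : Fin m → Fin n × Fin n
    loopless : ∀ e → proj₁ (ends e) ≢ proj₂ (ends e)
open Graph public

module _ (G : Graph) where

  Inc : Fin (m G) → Fin (n G) → Set
  Inc e v = (v ≡ proj₁ (ends G e)) ⊎ (v ≡ proj₂ (ends G e))

  inc? : ∀ e v → Dec (Inc e v)
  inc? e v = (v ≟F proj₁ (ends G e)) ⊎-dec (v ≟F proj₂ (ends G e))

  deg : Subset (m G) → Fin (n G) → ℕ
  deg S v = length (filter (λ e → (e ∈? S) ×-dec inc? e v) (allFin (m G)))

  Δ : ℕ
  Δ = foldr _⊔_ 0 (map (deg ⊤) (allFin (n G)))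

  Regular : Subset (m G) → ℕ → Set
  Regular S s = ∀ v → deg S v ≡ s

  data Reach (S : Subset (m G)) : Fin (n G) → Fin (n G) → Set where
    here : ∀ {u} → Reach S u u
    step : ∀ {u w} e → e ∈ S → Inc e u → ∀ {v} → Inc e v → Reach S v w → Reach S u w

  Connected : Set
  Connected = ∀ u v → Reach ⊤ u v

  Colourable : Subset (m G) → ℕ → Set
  Colourable S c = Σ (Fin (m G) → Fin c) λ col →
    ∀ e e' → e ≢ e' → e ∈ S → e' ∈ S → (∃[ v ] (Inc e v × Inc e' v)) → col e ≢ col e'

  _⊆ₑ_ : Subset (m G) → Subset (m G) → Set
  A ⊆ₑ B = ∀ {e} → e ∈ A → e ∈ B

  -- number of odd cycles of the spanning subgraph (V, F) (a 2-factor):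
  -- the number of connected components with an odd number of vertices.
  OddCycleCount : Subset (m G) → ℕ → Set
  OddCycleCount F k = Σ ℕ λ c → Σ (Fin (n G) → Fin c) λ comp →
      Surjective _≡_ _≡_ comp
    × (∀ u v → (comp u ≡ comp v) ⇔ Reach F u v)
    × length (filter (λ j → length (filter (λ v → comp v ≟F j) (allFin (n G))) % 2 ≟ℕ 1)
                     (allFin c)) ≡ k

  classOf : ∀ {k} → Subset (m G) → (Fin (m G) → Fin k) → Fin k → Subset (m G)
  classOf S f i = tabulate (λ e → does (e ∈? S) ∧ does (f e ≟F i))

  TwoFactorization : (S : Subset (m G)) (k : ℕ) → (Fin (m G) → Fin k) → Set
  TwoFactorization S k f = ∀ i → Regular (classOf S f i) 2

  OddTotal : (S : Subset (m G)) (k : ℕ) → (Fin (m G) → Fin k) → ℕ → Set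
  OddTotal S k f x = Σ (Fin k → ℕ) λ os →
    (∀ i → OddCycleCount (classOf S f i) (os i)) × sum (map os (allFin k)) ≡ x

data ℕ∞ : Set where
  fin : ℕ → ℕ∞
  ∞ : ℕ∞

data _≤∞_ : ℕ∞ → ℕ∞ → Set where
  fin≤fin : ∀ {a b} → a ≤ b → fin a ≤∞ fin b
  _≤∞∞ : ∀ a → a ≤∞ ∞

IsMinOf : (ℕ → Set) → ℕ∞ → Set
IsMinOf P (fin x) = P x × (∀ y → P y → x ≤ y)
IsMinOf P ∞ = ∀ y → ¬ P y

module _ (G : Graph) where

  Resistance : ℕ → Set
  Resistance = λ r → IsMinOf (λ y → Σ (Subset (m G)) λ R →
                        ∣ R ∣ ≡ y × Colourable G (∁ R) (Δ G)) (fin r)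

  EvenOddness : Subset (m G) → ℕ → ℕ∞ → Set
  EvenOddness S k = IsMinOf (λ y → Σ (Fin (m G) → Fin k) λ f →
                       TwoFactorization G S k f × OddTotal G S k f y)

  OneFactor : Subset (m G) → Set
  OneFactor F = Regular G F 1

  Oddness : ℕ → ℕ∞ → Set
  Oddness s x =
      (Σ ℕ λ k → s ≡ 2 * k × EvenOddness ⊤ k x)
    ⊎ (Σ ℕ λ k → s ≡ suc (2 * k) ×
         IsMinOf (λ y → Σ (Subset (m G)) λ F₁ → OneFactor F₁ × EvenOddness (∁ F₁) k (fin y)) x)

module Submission where

-- Colour the edges of the i-th 2-factor F of a 2-factorization with the colour pair (i, false), (i, true).
-- Within F, a vertex is a defect of a colouring when its two F-edges get the same colour. For the
-- constant colouring, every component of F contains as many defects as vertices; as long as some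
-- component contains two defects u ≠ w, adding (mod 2) the edge multiplicities of a u–w walk in F to the
-- colouring cures exactly u and w, so the number of defects in each component keeps the parity of the
-- component's size. Eventually each component contains at most one defect, and only odd components do;
-- deleting one F-edge at every defect leaves a proper colouring and removes at most as many edges as F
-- has odd cycles. For odd s the 1-factor gets one extra colour, so Δ(G) = s colours suffice once ξ(G)
-- edges are deleted.

open import Defs
open import Algebra.Bundles using (CommutativeRing)
open import Data.Bool using (Bool; true; false; not; _∧_; _xor_)
open import Data.Bool.Properties
  using (xor-∧-commutativeRing; xor-assoc; xor-same; xor-identityʳ; not-distribˡ-xor; ∧-identityʳ; ∧-zeroʳ; ¬-not)
  renaming (_≟_ to _≟ᴮ_)
open import Data.Fin using (Fin; zero; suc; punchIn; combine; cast; toℕ)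
open import Data.Fin.Properties
  using (any?; suc-injective; 0≢1+n; punchInᵢ≢i; combine-injective; toℕ-cast; toℕ-injective)
  renaming (_≟_ to _≟ᶠ_)
open import Data.Fin.Subset using (Subset; _∈_; ⊤; ∁; ∣_∣)
open import Data.Fin.Subset.Properties using (_∈?_; ∈⊤; x∈∁p⇒x∉p; x∉p⇒x∈∁p)
open import Data.List using (List; []; _∷_; length; filter; map; allFin; foldr)
import Data.List as List
open import Data.List.Membership.Propositional using () renaming (_∈_ to _∈ₗ_)
open import Data.List.Membership.Propositional.Properties using (∈-filter⁺; ∈-filter⁻; ∈-allFin)
open import Data.List.Relation.Unary.Any using (here; there)
open import Data.List.Relation.Unary.AllPairs using (_∷_)
open import Data.List.Relation.Unary.All using ([]; _∷_)
open import Data.List.Relation.Unary.Unique.Propositional using (Unique)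
open import Data.List.Relation.Unary.Unique.Propositional.Properties using (filter⁺; allFin⁺)
open import Data.Maybe using (Maybe; just; nothing)
open import Data.Maybe.Properties using (just-injective)
open import Data.Nat using (ℕ; zero; suc; _+_; _*_; _≤_; _<_; z≤n; s≤s; _%_; _⊔_)
import Data.Nat.ListAction as ListAction
open import Data.Nat.Induction using (<-wellFounded)
open import Data.Nat.Properties
  using (+-0-commutativeMonoid; +-mono-≤; ≤-trans; ≤-reflexive; m≤m+n; m≤n+m; n≤1+n; *-comm; ⊔-identityʳ; ⊔-idem)
  renaming (_≟_ to _≟ⁿ_)
open import Data.Product using (Σ; ∃; ∃₂; _×_; _,_; proj₁; proj₂)
open import Data.Product.Properties using (,-injective)
open import Data.Sum using (_⊎_; inj₁; inj₂)
open import Data.Vec using (tabulate)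
open import Data.Vec.Properties using (lookup∘tabulate; lookup⇒[]=)
open import Function using (_∘_; id; _⇔_; Equivalence)
open import Function.Definitions using (Injective)
open import Induction.WellFounded using (Acc; acc)
open import Relation.Binary.PropositionalEquality
open import Relation.Nullary using (Dec; yes; no; does; contradiction)
open import Relation.Nullary.Decidable using (dec-true; dec-false; _×-dec_; ¬?; toSum)
open import Algebra.Properties.CommutativeSemigroup
  (CommutativeRing.+-commutativeSemigroup xor-∧-commutativeRing) using (interchange)
open import Algebra.Properties.CommutativeMonoid.Sum +-0-commutativeMonoid
  using (sum; ∑-comm; sum-cong-≗; sum-remove)

open ≡-Reasoning

dec-true⁻ : ∀ {A : Set} (a? : Dec A) → does a? ≡ true → A
dec-true⁻ (yes a) _ = a

∧-true⁻ : ∀ {a b} → a ∧ b ≡ true → a ≡ true × b ≡ true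
∧-true⁻ {true} {true} _ = refl , refl

xor-cancel-middle : ∀ a b c → (a xor b) xor (b xor c) ≡ a xor c
xor-cancel-middle a b c = begin
  (a xor b) xor (b xor c)  ≡⟨ xor-assoc a b (b xor c) ⟩
  a xor (b xor (b xor c))  ≡⟨ cong (a xor_) (xor-assoc b b c) ⟨
  a xor ((b xor b) xor c)  ≡⟨ cong (λ z → a xor (z xor c)) (xor-same b) ⟩
  a xor c                  ∎

_≡ᵇ_ : ∀ {k} → Fin k → Fin k → Bool
x ≡ᵇ y = does (x ≟ᶠ y)

≡ᵇ-true : ∀ {k} {x y : Fin k} → x ≡ y → (x ≡ᵇ y) ≡ true
≡ᵇ-true = dec-true (_ ≟ᶠ _)

≡ᵇ-refl : ∀ {k} (x : Fin k) → (x ≡ᵇ x) ≡ true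
≡ᵇ-refl x = ≡ᵇ-true {x = x} refl

≡ᵇ-true⁻ : ∀ {k} {x y : Fin k} → (x ≡ᵇ y) ≡ true → x ≡ y
≡ᵇ-true⁻ = dec-true⁻ (_ ≟ᶠ _)

≡ᵇ-false : ∀ {k} {x y : Fin k} → x ≢ y → (x ≡ᵇ y) ≡ false
≡ᵇ-false = dec-false (_ ≟ᶠ _)

𝟙 : Bool → ℕ
𝟙 true  = 1
𝟙 false = 0

∑-mono-≤ : ∀ {n} {f g : Fin n → ℕ} → (∀ i → f i ≤ g i) → sum f ≤ sum g
∑-mono-≤ {zero}  _   = z≤n
∑-mono-≤ {suc n} f≤g = +-mono-≤ (f≤g zero) (∑-mono-≤ (f≤g ∘ suc))

term≤∑ : ∀ {n} (f : Fin n → ℕ) i → f i ≤ sum f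
term≤∑ f zero    = m≤m+n _ _
term≤∑ f (suc i) = ≤-trans (term≤∑ (f ∘ suc) i) (m≤n+m _ (f zero))

count : ∀ {n} → (Fin n → Bool) → ℕ
count P = sum (𝟙 ∘ P)

count-cong : ∀ {n} {P Q : Fin n → Bool} → (∀ x → P x ≡ Q x) → count P ≡ count Q
count-cong P≗Q = sum-cong-≗ (cong 𝟙 ∘ P≗Q)

count-false : ∀ n → count {n} (λ _ → false) ≡ 0
count-false zero    = refl
count-false (suc n) = count-false n

_without_ : ∀ {n} → (Fin n → Bool) → Fin n → Fin n → Bool
(P without x) y = P y ∧ not (y ≡ᵇ x)

without-self : ∀ {n} (P : Fin n → Bool) x → (P without x) x ≡ false
without-self P x rewrite ≡ᵇ-refl x = ∧-zeroʳ (P x)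

without-other : ∀ {n} (P : Fin n → Bool) {x y} → y ≢ x → (P without x) y ≡ P y
without-other P {y = y} y≢x rewrite ≡ᵇ-false y≢x = ∧-identityʳ (P y)

count-without : ∀ {n} {P : Fin n → Bool} x → P x ≡ true → count P ≡ suc (count (P without x))
count-without {suc n} {P} x Px = begin
  count P                                  ≡⟨ sum-remove {i = x} (𝟙 ∘ P) ⟩
  𝟙 (P x) + count (P ∘ punchIn x)          ≡⟨ cong₂ _+_ (cong 𝟙 Px) off-x ⟩
  suc (count (P′ ∘ punchIn x))             ≡⟨ cong (λ b → suc (𝟙 b + count (P′ ∘ punchIn x))) (without-self P x) ⟨
  suc (𝟙 (P′ x) + count (P′ ∘ punchIn x))  ≡⟨ cong suc (sum-remove {i = x} (𝟙 ∘ P′)) ⟨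
  suc (count P′)                           ∎
  where
  P′ = P without x
  off-x : count (P ∘ punchIn x) ≡ count (P′ ∘ punchIn x)
  off-x = count-cong (λ j → sym (without-other P (punchInᵢ≢i x j)))

count-remove₂ : ∀ {n} {P Q : Fin n → Bool} {u w} → u ≢ w →
                P u ≡ true → P w ≡ true → Q u ≡ false → Q w ≡ false →
                (∀ y → y ≢ u → y ≢ w → P y ≡ Q y) → count P ≡ 2 + count Q
count-remove₂ {P = P} {Q} {u} {w} u≢w Pu Pw Qu Qw P≗Q = begin
  count P                              ≡⟨ count-without u Pu ⟩
  suc (count (P without u))            ≡⟨ cong suc (count-without w (trans (without-other P (u≢w ∘ sym)) Pw)) ⟩
  2 + count ((P without u) without w)  ≡⟨ cong (2 +_) (count-cong P∖uw≗Q) ⟩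
  2 + count Q                          ∎
  where
  P∖uw≗Q : ∀ y → ((P without u) without w) y ≡ Q y
  P∖uw≗Q y with toSum (y ≟ᶠ w) | toSum (y ≟ᶠ u)
  ... | inj₁ refl | _         = trans (without-self (P without u) y) (sym Qw)
  ... | inj₂ y≢w  | inj₁ refl = trans (without-other (P without u) y≢w) (trans (without-self P y) (sym Qu))
  ... | inj₂ y≢w  | inj₂ y≢u  =
    trans (without-other (P without u) y≢w) (trans (without-other P y≢u) (P≗Q y y≢u y≢w))

count-unique : ∀ {n} {P : Fin n → Bool} x → P x ≡ true → (∀ y → P y ≡ true → y ≡ x) → count P ≡ 1
count-unique {n} {P} x Px only-x =
  trans (count-without x Px) (cong suc (trans (count-cong nothing-else) (count-false n)))
  where
  nothing-else : ∀ y → (P without x) y ≡ false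
  nothing-else y with toSum (y ≟ᶠ x)
  ... | inj₁ refl = without-self P y
  ... | inj₂ y≢x  = trans (without-other P y≢x) (¬-not (y≢x ∘ only-x y))

count-injection : ∀ {a b} {P : Fin a → Bool} {Q : Fin b → Bool} (f : ∀ x → P x ≡ true → Fin b) →
                  (∀ x p → Q (f x p) ≡ true) → (∀ {x y} p q → f x p ≡ f y q → x ≡ y) →
                  count P ≤ count Q
count-injection {zero}  f f∈Q f-inj = z≤n
count-injection {suc a} {P = P} {Q} f f∈Q f-inj with P zero in P₀
... | false = count-injection (f ∘ suc) (f∈Q ∘ suc) (λ p q → suc-injective ∘ f-inj p q)
... | true  = ≤-trans (s≤s (count-injection (f ∘ suc) f∘suc∈Q′ (λ p q → suc-injective ∘ f-inj p q)))
                      (≤-reflexive (sym (count-without y₀ (f∈Q zero P₀))))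
  where
  y₀ = f zero P₀
  f∘suc∈Q′ : ∀ x p → (Q without y₀) (f (suc x) p) ≡ true
  f∘suc∈Q′ x p = trans (without-other Q (0≢1+n ∘ f-inj P₀ p ∘ sym)) (f∈Q (suc x) p)

count-select≤∑ : ∀ {m k} (P : Fin k → Fin m → Bool) (g : Fin m → Fin k) →
                 count (λ e → P (g e) e) ≤ sum (λ i → count (P i))
count-select≤∑ P g = ≤-trans (∑-mono-≤ (λ e → term≤∑ (λ i → 𝟙 (P i e)) (g e)))
                             (≤-reflexive (∑-comm (λ e i → 𝟙 (P i e))))

length-filter-tabulate : ∀ {A : Set} {n} {P : A → Set} (P? : ∀ a → Dec (P a)) (g : Fin n → A) →
                         length (filter P? (List.tabulate g)) ≡ count (λ i → does (P? (g i)))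
length-filter-tabulate {n = zero}  P? g = refl
length-filter-tabulate {n = suc n} P? g with P? (g zero)
... | yes _ = cong suc (length-filter-tabulate P? (g ∘ suc))
... | no _  = length-filter-tabulate P? (g ∘ suc)

sum-map-tabulate : ∀ {A : Set} {n} (h : A → ℕ) (g : Fin n → A) →
                   ListAction.sum (map h (List.tabulate g)) ≡ sum (h ∘ g)
sum-map-tabulate {n = zero}  h g = refl
sum-map-tabulate {n = suc n} h g = cong (h (g zero) +_) (sum-map-tabulate h (g ∘ suc))

∣tabulate∣ : ∀ {n} (P : Fin n → Bool) → ∣ tabulate P ∣ ≡ count P
∣tabulate∣ {zero}  P = refl
∣tabulate∣ {suc n} P with P zero
... | true  = cong suc (∣tabulate∣ (P ∘ suc))
... | false = ∣tabulate∣ (P ∘ suc)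

∈tabulate : ∀ {n} {P : Fin n → Bool} {x} → P x ≡ true → x ∈ tabulate P
∈tabulate {P = P} {x} Px = lookup⇒[]= x (tabulate P) (trans (lookup∘tabulate P x) Px)

∈∁tabulate : ∀ {n} {P : Fin n → Bool} {x} → x ∈ ∁ (tabulate P) → P x ≡ false
∈∁tabulate x∈∁ = ¬-not (x∈∁p⇒x∉p x∈∁ ∘ ∈tabulate)

cast-injective : ∀ {a b} .{eq₁ eq₂ : a ≡ b} {x y : Fin a} → cast eq₁ x ≡ cast eq₂ y → x ≡ y
cast-injective {eq₁ = eq₁} {eq₂} {x} {y} eq =
  toℕ-injective (trans (sym (toℕ-cast eq₁ x)) (trans (cong toℕ eq) (toℕ-cast eq₂ y)))

fromBool : Bool → Fin 2
fromBool false = zero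
fromBool true  = suc zero

fromBool-injective : Injective _≡_ _≡_ fromBool
fromBool-injective {false} {false} _ = refl
fromBool-injective {true}  {true}  _ = refl

encode-pair : ∀ {k} → Fin k × Bool → Fin (k * 2)
encode-pair (i , b) = combine i (fromBool b)

encode-pair-injective : ∀ {k} → Injective _≡_ _≡_ (encode-pair {k})
encode-pair-injective {x = i , a} {j , b} eq with combine-injective i (fromBool a) j (fromBool b) eq
... | refl , fa≡fb = cong (i ,_) (fromBool-injective fa≡fb)

encode-maybe : ∀ {C : Set} {c} → (C → Fin c) → Maybe C → Fin (suc c)
encode-maybe encode nothing  = zero
encode-maybe encode (just x) = suc (encode x)

encode-maybe-injective : ∀ {C : Set} {c} {encode : C → Fin c} → Injective _≡_ _≡_ encode →
                         Injective _≡_ _≡_ (encode-maybe encode)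
encode-maybe-injective inj {nothing} {nothing} _  = refl
encode-maybe-injective inj {just x}  {just y}  eq = cong just (inj (suc-injective eq))

max-constant : ∀ {N s} (h : Fin N → ℕ) → (∀ v → h v ≡ s) → Fin N → foldr _⊔_ 0 (map h (allFin N)) ≡ s
max-constant {suc N} {s} h h≡s _ = go zero (List.tabulate suc)
  where
  go : ∀ v vs → foldr _⊔_ 0 (map h (v ∷ vs)) ≡ s
  go v []        = trans (⊔-identityʳ (h v)) (h≡s v)
  go v (v' ∷ vs) = trans (cong₂ _⊔_ (h≡s v) (go v' vs)) (⊔-idem s)

module _ (G : Graph) where

  ProperOn : {C : Set} → (Fin (m G) → Set) → (Fin (m G) → C) → Set
  ProperOn Kept col =
    ∀ {e e' v} → e ≢ e' → Kept e → Kept e' → Inc G e v → Inc G e' v → col e ≢ col e'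

  NearlyColourable : Subset (m G) → Set → ℕ → Set
  NearlyColourable S C d = Σ (Fin (m G) → Bool) λ R → Σ (Fin (m G) → C) λ col →
    count R ≤ d × ProperOn (λ e → e ∈ S × R e ≡ false) col

  Inc-ends : ∀ {e u v x} → Inc G e u → Inc G e v → u ≢ v → Inc G e x → x ≡ u ⊎ x ≡ v
  Inc-ends (inj₁ refl) _           _   (inj₁ refl) = inj₁ refl
  Inc-ends (inj₁ refl) (inj₁ refl) u≢v _           = contradiction refl u≢v
  Inc-ends (inj₁ refl) (inj₂ refl) _   (inj₂ refl) = inj₂ refl
  Inc-ends (inj₂ refl) _           _   (inj₂ refl) = inj₁ refl
  Inc-ends (inj₂ refl) (inj₂ refl) u≢v _           = contradiction refl u≢v
  Inc-ends (inj₂ refl) (inj₁ refl) _   (inj₁ refl) = inj₂ refl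

  ends-detect-incidence : ∀ {e u v} → Inc G e u → Inc G e v → u ≢ v →
                          ∀ x → (x ≡ᵇ u) xor (x ≡ᵇ v) ≡ does (inc? G e x)
  ends-detect-incidence {e} {u} {v} e∋u e∋v u≢v x with toSum (inc? G e x)
  ... | inj₂ e∌x = begin
    (x ≡ᵇ u) xor (x ≡ᵇ v)  ≡⟨ cong₂ _xor_ (≡ᵇ-false (not-an-end e∋u)) (≡ᵇ-false (not-an-end e∋v)) ⟩
    false                  ≡⟨ dec-false (inc? G e x) e∌x ⟨
    does (inc? G e x)      ∎
    where
    not-an-end : ∀ {y} → Inc G e y → x ≢ y
    not-an-end e∋y refl = e∌x e∋y
  ... | inj₁ e∋x = trans (one-of-two (Inc-ends e∋u e∋v u≢v e∋x)) (sym (dec-true (inc? G e x) e∋x))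
    where
    one-of-two : x ≡ u ⊎ x ≡ v → (x ≡ᵇ u) xor (x ≡ᵇ v) ≡ true
    one-of-two (inj₁ refl) rewrite ≡ᵇ-refl x | ≡ᵇ-false u≢v = refl
    one-of-two (inj₂ refl) rewrite ≡ᵇ-refl x | ≡ᵇ-false (u≢v ∘ sym) = refl

  module Incidence (S : Subset (m G)) where

    incident : Fin (n G) → List (Fin (m G))
    incident x = filter (λ e → (e ∈? S) ×-dec inc? G e x) (allFin (m G))

    ∈-incident⁺ : ∀ {e x} → e ∈ S → Inc G e x → e ∈ₗ incident x
    ∈-incident⁺ {e} {x} e∈S e∋x = ∈-filter⁺ (λ e → (e ∈? S) ×-dec inc? G e x) (∈-allFin e) (e∈S , e∋x)

    ∈-incident⁻ : ∀ {e x} → e ∈ₗ incident x → e ∈ S × Inc G e x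
    ∈-incident⁻ {x = x} = proj₂ ∘ ∈-filter⁻ (λ e → (e ∈? S) ×-dec inc? G e x) {xs = allFin (m G)}

    incident-unique : ∀ x → Unique (incident x)
    incident-unique x = filter⁺ (λ e → (e ∈? S) ×-dec inc? G e x) (allFin⁺ (m G))

  one-factor-unique : ∀ {F} → OneFactor G F →
                      ∀ {e e' x} → e ∈ F → e' ∈ F → Inc G e x → Inc G e' x → e ≡ e'
  one-factor-unique {F} F-1reg {e} {e'} {x} e∈F e'∈F e∋x e'∋x
    with incident x | F-1reg x | ∈-incident⁺ e∈F e∋x | ∈-incident⁺ e'∈F e'∋x
    where open Incidence F
  ... | _ ∷ [] | refl | here refl | here refl = refl

  module TwoRegular {F : Subset (m G)} (F-2reg : Regular G F 2) where

    open Incidence F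

    incident-pair : ∀ x → Σ (Fin (m G)) λ a → Σ (Fin (m G)) λ b → incident x ≡ a ∷ b ∷ []
    incident-pair x with incident x | F-2reg x
    ... | a ∷ b ∷ [] | refl = a , b , refl

    edge₁ edge₂ : Fin (n G) → Fin (m G)
    edge₁ x = proj₁ (incident-pair x)
    edge₂ x = proj₁ (proj₂ (incident-pair x))

    incident≡ : ∀ x → incident x ≡ edge₁ x ∷ edge₂ x ∷ []
    incident≡ x = proj₂ (proj₂ (incident-pair x))

    edge₁-incident : ∀ x → edge₁ x ∈ F × Inc G (edge₁ x) x
    edge₁-incident x = ∈-incident⁻ (subst (edge₁ x ∈ₗ_) (sym (incident≡ x)) (here refl))

    edge₂-incident : ∀ x → edge₂ x ∈ F × Inc G (edge₂ x) x
    edge₂-incident x = ∈-incident⁻ (subst (edge₂ x ∈ₗ_) (sym (incident≡ x)) (there (here refl)))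

    edge₁≢edge₂ : ∀ x → edge₁ x ≢ edge₂ x
    edge₁≢edge₂ x with subst Unique (incident≡ x) (incident-unique x)
    ... | (edge₁≢edge₂ ∷ []) ∷ _ = edge₁≢edge₂

    edge-at : ∀ {e x} → e ∈ F → Inc G e x → e ≡ edge₁ x ⊎ e ≡ edge₂ x
    edge-at e∈F e∋x with subst (_ ∈ₗ_) (incident≡ _) (∈-incident⁺ e∈F e∋x)
    ... | here e≡edge₁        = inj₁ e≡edge₁
    ... | there (here e≡edge₂) = inj₂ e≡edge₂

    edges-detect-incidence : ∀ {e} → e ∈ F →
                             ∀ x → (edge₁ x ≡ᵇ e) xor (edge₂ x ≡ᵇ e) ≡ does (inc? G e x)
    edges-detect-incidence {e} e∈F x with toSum (inc? G e x)
    ... | inj₂ e∌x = begin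
      (edge₁ x ≡ᵇ e) xor (edge₂ x ≡ᵇ e)  ≡⟨ cong₂ _xor_ (≡ᵇ-false (not-e (proj₂ (edge₁-incident x))))
                                                        (≡ᵇ-false (not-e (proj₂ (edge₂-incident x)))) ⟩
      false                              ≡⟨ dec-false (inc? G e x) e∌x ⟨
      does (inc? G e x)                  ∎
      where
      not-e : ∀ {a} → Inc G a x → a ≢ e
      not-e a∋x refl = e∌x a∋x
    ... | inj₁ e∋x = trans (one-of-two (edge-at e∈F e∋x)) (sym (dec-true (inc? G e x) e∋x))
      where
      one-of-two : e ≡ edge₁ x ⊎ e ≡ edge₂ x → (edge₁ x ≡ᵇ e) xor (edge₂ x ≡ᵇ e) ≡ true
      one-of-two (inj₁ refl) rewrite ≡ᵇ-refl e | ≡ᵇ-false (edge₁≢edge₂ x ∘ sym) = refl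
      one-of-two (inj₂ refl) rewrite ≡ᵇ-refl e | ≡ᵇ-false (edge₁≢edge₂ x) = refl

    -- A step between equal vertices traverses no edge, so it is skipped.
    parity : ∀ {u w} → Reach G F u w → Fin (m G) → Bool
    parity here e = false
    parity (step {u} e₀ _ _ {v} _ r) e with u ≟ᶠ v
    ... | yes _ = parity r e
    ... | no _  = (e ≡ᵇ e₀) xor parity r e

    parity-balance : ∀ {u w} (r : Reach G F u w) x →
                     parity r (edge₁ x) xor parity r (edge₂ x) ≡ (x ≡ᵇ u) xor (x ≡ᵇ w)
    parity-balance {u} here x = sym (xor-same (x ≡ᵇ u))
    parity-balance {w = w} (step {u} e₀ e₀∈F e₀∋u {v} e₀∋v r) x with u ≟ᶠ v
    ... | yes refl = parity-balance r x
    ... | no u≢v   = begin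
      ((edge₁ x ≡ᵇ e₀) xor parity r (edge₁ x)) xor ((edge₂ x ≡ᵇ e₀) xor parity r (edge₂ x))
        ≡⟨ interchange (edge₁ x ≡ᵇ e₀) (parity r (edge₁ x)) (edge₂ x ≡ᵇ e₀) (parity r (edge₂ x)) ⟩
      ((edge₁ x ≡ᵇ e₀) xor (edge₂ x ≡ᵇ e₀)) xor (parity r (edge₁ x) xor parity r (edge₂ x))
        ≡⟨ cong₂ _xor_ (trans (edges-detect-incidence e₀∈F x) (sym (ends-detect-incidence e₀∋u e₀∋v u≢v x)))
                       (parity-balance r x) ⟩
      ((x ≡ᵇ u) xor (x ≡ᵇ v)) xor ((x ≡ᵇ v) xor (x ≡ᵇ w))
        ≡⟨ xor-cancel-middle (x ≡ᵇ u) (x ≡ᵇ v) (x ≡ᵇ w) ⟩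
      (x ≡ᵇ u) xor (x ≡ᵇ w) ∎

    defect : (Fin (m G) → Bool) → Fin (n G) → Bool
    defect col x = not (col (edge₁ x) xor col (edge₂ x))

    defect-flip : ∀ {u w} (r : Reach G F u w) col x →
                  defect (λ e → col e xor parity r e) x ≡ defect col x xor ((x ≡ᵇ u) xor (x ≡ᵇ w))
    defect-flip {u} {w} r col x = begin
      not ((col (edge₁ x) xor parity r (edge₁ x)) xor (col (edge₂ x) xor parity r (edge₂ x)))
        ≡⟨ cong not (interchange (col (edge₁ x)) (parity r (edge₁ x)) (col (edge₂ x)) (parity r (edge₂ x))) ⟩
      not ((col (edge₁ x) xor col (edge₂ x)) xor (parity r (edge₁ x) xor parity r (edge₂ x)))
        ≡⟨ not-distribˡ-xor (col (edge₁ x) xor col (edge₂ x)) (parity r (edge₁ x) xor parity r (edge₂ x)) ⟩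
      defect col x xor (parity r (edge₁ x) xor parity r (edge₂ x))
        ≡⟨ cong (defect col x xor_) (parity-balance r x) ⟩
      defect col x xor ((x ≡ᵇ u) xor (x ≡ᵇ w)) ∎

    module Components {c} (comp : Fin (n G) → Fin c)
                      (connects : ∀ u v → (comp u ≡ comp v) ⇔ Reach G F u v) where

      member : Fin c → Fin (n G) → Bool
      member j x = comp x ≡ᵇ j

      defectsIn : (Fin (m G) → Bool) → Fin c → Fin (n G) → Bool
      defectsIn col j x = member j x ∧ defect col x

      Balanced : (Fin (m G) → Bool) → Set
      Balanced col = ∀ j → count (defectsIn col j) % 2 ≡ count (member j) % 2

      Separated : (Fin (m G) → Bool) → Set
      Separated col = ∀ {u w} → defect col u ≡ true → defect col w ≡ true → comp u ≡ comp w → u ≡ w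

      balanced-constant : Balanced (λ _ → false)
      balanced-constant j = cong (_% 2) (count-cong (λ x → ∧-identityʳ (member j x)))

      module Flip (col : Fin (m G) → Bool) {u w} (u≢w : u ≢ w)
                  (u-defect : defect col u ≡ true) (w-defect : defect col w ≡ true)
                  (same-component : comp u ≡ comp w) where

        flipped : Fin (m G) → Bool
        flipped e = col e xor parity (Equivalence.to (connects u w) same-component) e

        flipped-defect : ∀ x → defect flipped x ≡ defect col x xor ((x ≡ᵇ u) xor (x ≡ᵇ w))
        flipped-defect = defect-flip (Equivalence.to (connects u w) same-component) col

        flipped-u : defect flipped u ≡ false
        flipped-u =
          trans (flipped-defect u) (cong₂ _xor_ u-defect (cong₂ _xor_ (≡ᵇ-refl u) (≡ᵇ-false u≢w)))

        flipped-w : defect flipped w ≡ false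
        flipped-w =
          trans (flipped-defect w) (cong₂ _xor_ w-defect (cong₂ _xor_ (≡ᵇ-false (u≢w ∘ sym)) (≡ᵇ-refl w)))

        flipped-elsewhere : ∀ x → x ≢ u → x ≢ w → defect col x ≡ defect flipped x
        flipped-elsewhere x x≢u x≢w = sym (begin
          defect flipped x
            ≡⟨ flipped-defect x ⟩
          defect col x xor ((x ≡ᵇ u) xor (x ≡ᵇ w))
            ≡⟨ cong (defect col x xor_) (cong₂ _xor_ (≡ᵇ-false x≢u) (≡ᵇ-false x≢w)) ⟩
          defect col x xor false
            ≡⟨ xor-identityʳ (defect col x) ⟩
          defect col x ∎)

        count-flipped : count (defect col) ≡ 2 + count (defect flipped)
        count-flipped = count-remove₂ u≢w u-defect w-defect flipped-u flipped-w flipped-elsewhere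

        balanced-flipped : Balanced col → Balanced flipped
        balanced-flipped balanced j with toSum (comp u ≟ᶠ j)
        ... | inj₁ refl = begin
          count (defectsIn flipped j) % 2       ≡⟨⟩
          (2 + count (defectsIn flipped j)) % 2 ≡⟨ cong (_% 2) in-j ⟨
          count (defectsIn col j) % 2           ≡⟨ balanced j ⟩
          count (member j) % 2                  ∎
          where
          in-j : count (defectsIn col j) ≡ 2 + count (defectsIn flipped j)
          in-j = count-remove₂ u≢w
            (cong₂ _∧_ (≡ᵇ-refl (comp u)) u-defect)
            (cong₂ _∧_ (≡ᵇ-true (sym same-component)) w-defect)
            (trans (cong (member j u ∧_) flipped-u) (∧-zeroʳ _))
            (trans (cong (member j w ∧_) flipped-w) (∧-zeroʳ _))
            (λ x x≢u x≢w → cong (member j x ∧_) (flipped-elsewhere x x≢u x≢w))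
        ... | inj₂ u∉j = trans (cong (_% 2) (count-cong unchanged)) (balanced j)
          where
          unchanged : ∀ x → defectsIn flipped j x ≡ defectsIn col j x
          unchanged x with toSum (x ≟ᶠ u) | toSum (x ≟ᶠ w)
          ... | inj₁ refl | _         rewrite ≡ᵇ-false u∉j = refl
          ... | inj₂ _    | inj₁ refl rewrite ≡ᵇ-false (u∉j ∘ trans same-component) = refl
          ... | inj₂ x≢u  | inj₂ x≢w  = cong (member j x ∧_) (sym (flipped-elsewhere x x≢u x≢w))

      TwoDefects : (Fin (m G) → Bool) → Set
      TwoDefects col = ∃₂ λ u w → u ≢ w × defect col u ≡ true × defect col w ≡ true × comp u ≡ comp w

      two-defects? : ∀ col → Dec (TwoDefects col)
      two-defects? col = any? λ u → any? λ w →
        ¬? (u ≟ᶠ w) ×-dec (defect col u ≟ᴮ true) ×-dec (defect col w ≟ᴮ true) ×-dec (comp u ≟ᶠ comp w)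

      separate : ∀ col → Balanced col → Acc _<_ (count (defect col)) →
                 Σ (Fin (m G) → Bool) λ col′ → Balanced col′ × Separated col′
      separate col balanced (acc smaller) with two-defects? col
      ... | no none = col , balanced , separated
        where
        separated : Separated col
        separated {u} {w} u-defect w-defect same with u ≟ᶠ w
        ... | yes u≡w = u≡w
        ... | no u≢w  = contradiction (u , w , u≢w , u-defect , w-defect , same) none
      ... | yes (u , w , u≢w , u-defect , w-defect , same) =
        separate flipped (balanced-flipped balanced)
                 (smaller (≤-trans (n≤1+n _) (≤-reflexive (sym count-flipped))))
        where open Flip col u≢w u-defect w-defect same

      odd : Fin c → Bool
      odd j = does (count (member j) % 2 ≟ⁿ 1)

      module Repair (col : Fin (m G) → Bool) (balanced : Balanced col) (separated : Separated col) where

        defect-in-odd-component : ∀ {x} → defect col x ≡ true → odd (comp x) ≡ true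
        defect-in-odd-component {x} x-defect = dec-true (_ ≟ⁿ 1) (begin
          count (member (comp x)) % 2         ≡⟨ balanced (comp x) ⟨
          count (defectsIn col (comp x)) % 2  ≡⟨ cong (_% 2) (count-unique x x∈ only-x) ⟩
          1                                   ∎)
          where
          x∈ : defectsIn col (comp x) x ≡ true
          x∈ = cong₂ _∧_ (≡ᵇ-refl (comp x)) x-defect
          only-x : ∀ y → defectsIn col (comp x) y ≡ true → y ≡ x
          only-x y y∈ with ∧-true⁻ {member (comp x) y} y∈
          ... | y-member , y-defect = separated y-defect x-defect (≡ᵇ-true⁻ y-member)

        Witness : Fin (m G) → Fin (n G) → Set
        Witness e x = defect col x ≡ true × edge₁ x ≡ e

        removed : Fin (m G) → Bool
        removed e = does (any? λ x → (defect col x ≟ᴮ true) ×-dec (edge₁ x ≟ᶠ e))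

        removed-edge₁ : ∀ {x} → defect col x ≡ true → removed (edge₁ x) ≡ true
        removed-edge₁ {x} x-defect = dec-true (any? _) (x , x-defect , refl)

        count-removed : count removed ≤ count odd
        count-removed = count-injection (λ e e-removed → comp (proj₁ (witness e-removed)))
          (λ e e-removed → defect-in-odd-component (proj₁ (proj₂ (witness e-removed))))
          injective
          where
          witness : ∀ {e} → removed e ≡ true → ∃ (Witness e)
          witness = dec-true⁻ (any? _)
          injective : ∀ {e e'} (p : removed e ≡ true) (q : removed e' ≡ true) →
                      comp (proj₁ (witness p)) ≡ comp (proj₁ (witness q)) → e ≡ e'
          injective p q same-component with witness p | witness q
          ... | x , x-defect , refl | y , y-defect , refl = cong edge₁ (separated x-defect y-defect same-component)

        kept-edge₁-proper : ∀ {v} → removed (edge₁ v) ≡ false → col (edge₁ v) ≢ col (edge₂ v)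
        kept-edge₁-proper {v} kept same = contradiction (trans (sym (removed-edge₁ v-defect)) kept) λ ()
          where
          v-defect : defect col v ≡ true
          v-defect = cong not (trans (cong (_xor col (edge₂ v)) same) (xor-same (col (edge₂ v))))

        proper : ProperOn (λ e → e ∈ F × removed e ≡ false) col
        proper {e} {e'} {v} e≢e' (e∈F , e-kept) (e'∈F , e'-kept) e∋v e'∋v same-colour
          with edge-at e∈F e∋v | edge-at e'∈F e'∋v
        ... | inj₁ refl | inj₁ refl = e≢e' refl
        ... | inj₂ refl | inj₂ refl = e≢e' refl
        ... | inj₁ refl | inj₂ refl = kept-edge₁-proper e-kept same-colour
        ... | inj₂ refl | inj₁ refl = kept-edge₁-proper e'-kept (sym same-colour)

  two-factor-nearly-colourable : ∀ {F k} → Regular G F 2 → OddCycleCount G F k → NearlyColourable F Bool k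
  two-factor-nearly-colourable {F} {k} F-2reg (c , comp , _ , connects , odd-count) =
    removed , col , ≤-trans count-removed (≤-reflexive count-odd) , proper
    where
    open TwoRegular F-2reg
    open Components comp connects
    separated-colouring : Σ (Fin (m G) → Bool) λ col → Balanced col × Separated col
    separated-colouring = separate (λ _ → false) balanced-constant (<-wellFounded _)
    col = proj₁ separated-colouring
    open Repair col (proj₁ (proj₂ separated-colouring)) (proj₂ (proj₂ separated-colouring))
    count-odd : count odd ≡ k
    count-odd = begin
      count odd
        ≡⟨ count-cong (λ j → cong (λ size → does (size % 2 ≟ⁿ 1))
                                  (sym (length-filter-tabulate (λ v → comp v ≟ᶠ j) id))) ⟩
      count (λ j → does (length (filter (λ v → comp v ≟ᶠ j) (allFin (n G))) % 2 ≟ⁿ 1))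
        ≡⟨ length-filter-tabulate (λ j → length (filter (λ v → comp v ≟ᶠ j) (allFin (n G))) % 2 ≟ⁿ 1) id ⟨
      length (filter (λ j → length (filter (λ v → comp v ≟ᶠ j) (allFin (n G))) % 2 ≟ⁿ 1) (allFin c))
        ≡⟨ odd-count ⟩
      k ∎

  ∈classOf : ∀ {S k} {f : Fin (m G) → Fin k} {e i} → e ∈ S → f e ≡ i → e ∈ classOf G S f i
  ∈classOf {S} {f = f} {e} {i} e∈S fe≡i =
    ∈tabulate (cong₂ _∧_ (dec-true (e ∈? S) e∈S) (dec-true (f e ≟ᶠ i) fe≡i))

  factorization-nearly-colourable : ∀ {S k ξ} f → TwoFactorization G S k f → OddTotal G S k f ξ →
                                    NearlyColourable S (Fin k × Bool) ξ
  factorization-nearly-colourable {S} {k} {ξ} f factors (odd , odd-counts , odd-total) =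
    removed , colour , count-removed , proper
    where
    nearly : ∀ i → NearlyColourable (classOf G S f i) Bool (odd i)
    nearly i = two-factor-nearly-colourable (factors i) (odd-counts i)
    removedᵢ colourᵢ : Fin k → Fin (m G) → Bool
    removedᵢ i = proj₁ (nearly i)
    colourᵢ i  = proj₁ (proj₂ (nearly i))

    removed : Fin (m G) → Bool
    removed e = removedᵢ (f e) e
    colour : Fin (m G) → Fin k × Bool
    colour e = f e , colourᵢ (f e) e

    count-removed : count removed ≤ ξ
    count-removed = ≤-trans (count-select≤∑ removedᵢ f)
                   (≤-trans (∑-mono-≤ (proj₁ ∘ proj₂ ∘ proj₂ ∘ nearly))
                   (≤-reflexive (trans (sym (sum-map-tabulate odd id)) odd-total)))

    kept-in-class : ∀ {e i} → e ∈ S → f e ≡ i → removed e ≡ false →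
                    e ∈ classOf G S f i × removedᵢ i e ≡ false
    kept-in-class e∈S refl kept = ∈classOf {f = f} e∈S refl , kept

    proper : ProperOn (λ e → e ∈ S × removed e ≡ false) colour
    proper {e} {e'} e≢e' (e∈S , e-kept) (e'∈S , e'-kept) e∋v e'∋v same-colour
      with ,-injective same-colour
    ... | same-factor , same-colourᵢ = proj₂ (proj₂ (proj₂ (nearly (f e)))) e≢e'
      (kept-in-class e∈S refl e-kept) (kept-in-class e'∈S (sym same-factor) e'-kept) e∋v e'∋v
      (trans same-colourᵢ (cong (λ i → colourᵢ i e') (sym same-factor)))

  extend-by-one-factor : ∀ {F₁ C d} → OneFactor G F₁ → NearlyColourable (∁ F₁) C d →
                         NearlyColourable ⊤ (Maybe C) d
  extend-by-one-factor {F₁} {C} F₁-1reg (removed , colour , count-removed , proper) =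
    removed , colour′ , count-removed , proper′
    where
    colour′ : Fin (m G) → Maybe C
    colour′ e with e ∈? F₁
    ... | yes _ = nothing
    ... | no _  = just (colour e)

    proper′ : ProperOn (λ e → e ∈ ⊤ × removed e ≡ false) colour′
    proper′ {e} {e'} e≢e' (_ , e-kept) (_ , e'-kept) e∋v e'∋v with e ∈? F₁ | e' ∈? F₁
    ... | yes e∈F₁ | yes e'∈F₁ = λ _ → e≢e' (one-factor-unique F₁-1reg e∈F₁ e'∈F₁ e∋v e'∋v)
    ... | yes _    | no _      = λ ()
    ... | no _     | yes _     = λ ()
    ... | no e∉F₁  | no e'∉F₁  =
      proper e≢e' (x∉p⇒x∈∁p e∉F₁ , e-kept) (x∉p⇒x∈∁p e'∉F₁ , e'-kept) e∋v e'∋v ∘ just-injective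

  -- The hypothesis on c refers to an edge because Δ of a graph without vertices is 0 whatever s is.
  nearly-colourable⇒deletion : ∀ {C d c} → NearlyColourable ⊤ C d →
    (encode : C → Fin c) → Injective _≡_ _≡_ encode → (Fin (m G) → c ≡ Δ G) →
    Σ (Subset (m G)) λ R → ∣ R ∣ ≤ d × Colourable G (∁ R) (Δ G)
  nearly-colourable⇒deletion (removed , colour , count-removed , proper) encode encode-injective c≡Δ =
    tabulate removed , ≤-trans (≤-reflexive (∣tabulate∣ removed)) count-removed , colour′ , proper′
    where
    colour′ : Fin (m G) → Fin (Δ G)
    colour′ e = cast (c≡Δ e) (encode (colour e))
    proper′ : ∀ e e' → e ≢ e' → e ∈ ∁ (tabulate removed) → e' ∈ ∁ (tabulate removed) →
              ∃ (λ v → Inc G e v × Inc G e' v) → colour′ e ≢ colour′ e'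
    proper′ e e' e≢e' e-kept e'-kept (v , e∋v , e'∋v) =
      proper e≢e' (∈⊤ , ∈∁tabulate e-kept) (∈⊤ , ∈∁tabulate e'-kept) e∋v e'∋v
        ∘ encode-injective ∘ cast-injective

  Δ-regular : ∀ {s} → Regular G ⊤ s → Fin (n G) → Δ G ≡ s
  Δ-regular = max-constant (deg G ⊤)

  oddness-deletion : ∀ {s ξ} → Regular G ⊤ s → Oddness G s (fin ξ) →
                     Σ (Subset (m G)) λ R → ∣ R ∣ ≤ ξ × Colourable G (∁ R) (Δ G)
  oddness-deletion {s} regular (inj₁ (k , s≡2k , (f , factors , odd-total) , _)) =
    nearly-colourable⇒deletion (factorization-nearly-colourable f factors odd-total)
      encode-pair encode-pair-injective
      (λ e → trans (*-comm k 2) (trans (sym s≡2k) (sym (Δ-regular regular (proj₁ (ends G e))))))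
  oddness-deletion {s} regular (inj₂ (k , s≡2k+1 , (F₁ , F₁-1reg , (f , factors , odd-total) , _) , _)) =
    nearly-colourable⇒deletion
      (extend-by-one-factor F₁-1reg (factorization-nearly-colourable f factors odd-total))
      (encode-maybe encode-pair) (encode-maybe-injective encode-pair-injective)
      (λ e → trans (cong suc (*-comm k 2)) (trans (sym s≡2k+1) (sym (Δ-regular regular (proj₁ (ends G e))))))

lemma2p3 : (G : Graph) (s : ℕ) → Connected G → Regular G ⊤ s →
    ∀ (r : ℕ) (x : ℕ∞) → Resistance G r → Oddness G s x → fin r ≤∞ x
lemma2p3 G s _ regular r ∞       _               _       = fin r ≤∞∞
lemma2p3 G s _ regular r (fin ξ) (_ , minimal) oddness with oddness-deletion G regular oddness
... | R , ∣R∣≤ξ , colourable = fin≤fin (≤-trans (minimal ∣ R ∣ (R , refl , colourable)) ∣R∣≤ξ)
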